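{- Let $f:2^V\to\mathbb{Z}$ be submodular with $f(\emptyset)=0$, $|V|=n$, and let $\mathcal{F}$ be a ring family on $V$ given by an acyclic digraph $D=(V,A)$. If $y\in\mathcal{B}(f)$ is non-degenerate and satisfies $y_i>-(n-1)\min_jy_j$, then $i$ is not contained in any minimizer of $f$ over $\mathcal{F}$.
   Context: The ring family represented by $D=(V,A)$ is $\mathcal{F}=\{S\subseteq V:\text{for every }(i,j)\in A,\ i\in S\Rightarrow j\in S\}$ (it contains $\emptyset$ and $V$). The base polyhedron is $\mathcal{B}(f)=\{y\in\mathbb{R}^V: y(S)\le f(S)\ \forall S\subsetneq V,\ y(V)=f(V)\}$ with $y(S)=\sum_{i\in S}y_i$. A vector $y\in\mathcal{B}(f)$ is non-degenerate if it has both positive and negative entries.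
   Formalization: The point y of the base polyhedron B(f) is taken in ℚ^V rather than $\mathbb{R}^V$. -}

module Defs where

open import Data.Nat using (ℕ; zero; suc)
open import Data.Fin using (Fin; zero; suc)
open import Data.Fin.Subset using (Subset; _∈_; _∉_; _∪_; _∩_; ⊤; ⊥)
open import Data.Vec using ([]; _∷_)
open import Data.Bool using (Bool; true; false)
open import Data.Integer using (ℤ)
import Data.Integer as ℤ
open import Data.Rational using (ℚ; 0ℚ; _+_; _*_; -_; _<_; _≤_; _/_; _>_)
open import Data.Product using (_×_; _,_; ∃)
open import Data.List using (List)
open import Data.List.Membership.Propositional using () renaming (_∈_ to _∈ₗ_)
open import Relation.Binary.Construct.Closure.Transitive using (TransClosure)
open import Relation.Binary.PropositionalEquality using (_≡_)
open import Relation.Nullary using (¬_)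

Submodular : ∀ {n} → (Subset n → ℤ) → Set
Submodular {n} f = ∀ (S T : Subset n) → f (S ∪ T) ℤ.+ f (S ∩ T) ℤ.≤ f S ℤ.+ f T

Digraph : ℕ → Set
Digraph n = List (Fin n × Fin n)

Arc : ∀ {n} → Digraph n → Fin n → Fin n → Set
Arc A i j = (i , j) ∈ₗ A

Acyclic : ∀ {n} → Digraph n → Set
Acyclic {n} A = ∀ (i : Fin n) → ¬ TransClosure (Arc A) i i

InRingFamily : ∀ {n} → Digraph n → Subset n → Set
InRingFamily {n} A S = ∀ (i j : Fin n) → Arc A i j → i ∈ S → j ∈ S

sumOver : ∀ {n} → (Fin n → ℚ) → Subset n → ℚ
sumOver {zero}  y []            = 0ℚ
sumOver {suc n} y (true  ∷ S)   = y zero + sumOver (λ k → y (suc k)) S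
sumOver {suc n} y (false ∷ S)   = sumOver (λ k → y (suc k)) S

toℚ : ℤ → ℚ
toℚ z = z / 1

InBase : ∀ {n} → (Subset n → ℤ) → (Fin n → ℚ) → Set
InBase {n} f y =
  (∀ (S : Subset n) → ¬ (S ≡ ⊤) → sumOver y S ≤ toℚ (f S)) × (sumOver y ⊤ ≡ toℚ (f ⊤))

NonDegenerate : ∀ {n} → (Fin n → ℚ) → Set
NonDegenerate {n} y = (∃ λ (i : Fin n) → y i > 0ℚ) × (∃ λ (j : Fin n) → y j < 0ℚ)

IsMinimizerOver : ∀ {n} → Digraph n → (Subset n → ℤ) → Subset n → Set
IsMinimizerOver {n} A f S =
  InRingFamily A S × (∀ (T : Subset n) → InRingFamily A T → f S ℤ.≤ f T)

{-# OPTIONS --safe #-}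
-- Let m = y j₀ be the least entry of y; it is negative because y is non-degenerate.
-- If i ∈ S then y(S) ≥ y i + (n - 1) m > 0, as the other members of S contribute at
-- least m each and m ≤ 0. Hence f(S) ≥ y(S) > 0 = f(∅), while ∅ belongs to every ring
-- family, so S is not a minimiser.
module Submission where

open import Defs
open import Data.Nat using (ℕ; zero; suc)
open import Data.Fin using (Fin; zero; suc)
open import Data.Fin.Subset using (Subset; _∈_; _∉_; ⊥; ⊤)
open import Data.Fin.Subset.Properties using (∉⊥)
open import Data.Vec using ([]; _∷_)
open import Data.Vec.Base using (here; there)
open import Data.Vec.Properties using (≡-dec)
open import Data.Bool using (true; false)
import Data.Bool as Bool
open import Data.Integer using (ℤ; +_; _-_)
import Data.Integer as ℤ
import Data.Integer.Properties as ℤ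
open import Data.Nat.Coprimality using (Coprime; 1-coprimeTo)
import Data.Nat.Coprimality as Coprimality
open import Data.Rational using (ℚ; mkℚ; 0ℚ; 1ℚ; +-0-rawMonoid; _+_; _*_; -_; _<_; _>_; _≤_; _/_; *<*)
open import Data.Rational.Properties
open import Algebra.Bundles using (CommutativeMonoid)
open import Algebra.Definitions.RawMonoid +-0-rawMonoid using (_×_)
open import Algebra.Properties.CommutativeSemigroup
  (CommutativeMonoid.commutativeSemigroup +-0-commutativeMonoid) using (x∙yz≈y∙xz)
open import Data.Product using (_,_)
open import Data.Empty using (⊥-elim)
open import Relation.Nullary using (yes; no)
open import Relation.Binary.PropositionalEquality

private
  variable
    n : ℕ
    m p q : ℚ

coprimeTo-1 : ∀ k → Coprime k 1
coprimeTo-1 k = Coprimality.sym (1-coprimeTo k)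

toℚ≡mkℚ : ∀ z → toℚ z ≡ mkℚ z 0 (coprimeTo-1 ℤ.∣ z ∣)
toℚ≡mkℚ (+ k)      = normalize-coprime (coprimeTo-1 k)
toℚ≡mkℚ ℤ.-[1+ k ] = cong -_ (normalize-coprime (coprimeTo-1 (suc k)))

toℚ-cancel-< : ∀ {a b} → toℚ a < toℚ b → a ℤ.< b
toℚ-cancel-< {a} {b} ta<tb with subst₂ _<_ (toℚ≡mkℚ a) (toℚ≡mkℚ b) ta<tb
... | *<* a*1<b*1 = subst₂ ℤ._<_ (ℤ.*-identityʳ a) (ℤ.*-identityʳ b) a*1<b*1

toℚ-suc : ∀ k → toℚ (+ suc k) ≡ 1ℚ + toℚ (+ k)
toℚ-suc k = begin
  -- ℚ's _+_ unfolds to (↥p ↧q + ↥q ↧p) / (↧p ↧q)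
  toℚ (+ suc k)                         ≡⟨ cong (λ z → (+ 1 ℤ.+ z) / 1) (sym (ℤ.*-identityʳ (+ k))) ⟩
  1ℚ + mkℚ (+ k) 0 (coprimeTo-1 k)      ≡⟨ cong (λ q → 1ℚ + q) (sym (toℚ≡mkℚ (+ k))) ⟩
  1ℚ + toℚ (+ k)                        ∎
  where open ≡-Reasoning

k×p≡toℚ[k]*p : ∀ k p → k × p ≡ toℚ (+ k) * p
k×p≡toℚ[k]*p zero    p = sym (*-zeroˡ p)
k×p≡toℚ[k]*p (suc k) p = begin
  p + k × p                ≡⟨ cong₂ _+_ (sym (*-identityˡ p)) (k×p≡toℚ[k]*p k p) ⟩
  1ℚ * p + toℚ (+ k) * p   ≡⟨ sym (*-distribʳ-+ p 1ℚ (toℚ (+ k))) ⟩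
  (1ℚ + toℚ (+ k)) * p     ≡⟨ cong (_* p) (sym (toℚ-suc k)) ⟩
  toℚ (+ suc k) * p        ∎
  where open ≡-Reasoning

p≤0⇒p+q≤q : p ≤ 0ℚ → p + q ≤ q
p≤0⇒p+q≤q {p} {q} p≤0 = ≤-trans (+-monoˡ-≤ q p≤0) (≤-reflexive (+-identityˡ q))

n×min≤sumOver : {y : Fin n → ℚ} → m ≤ 0ℚ → (∀ j → m ≤ y j) → ∀ S → n × m ≤ sumOver y S
n×min≤sumOver {zero}  m≤0 m≤y []          = ≤-refl
n×min≤sumOver {suc n} m≤0 m≤y (true ∷ S)  =
  +-mono-≤ (m≤y zero) (n×min≤sumOver m≤0 (λ j → m≤y (suc j)) S)
n×min≤sumOver {suc n} m≤0 m≤y (false ∷ S) =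
  ≤-trans (p≤0⇒p+q≤q m≤0) (n×min≤sumOver m≤0 (λ j → m≤y (suc j)) S)

y[i]+n×min≤sumOver : {y : Fin (suc n) → ℚ} → m ≤ 0ℚ → (∀ j → m ≤ y j) →
                     ∀ S i → i ∈ S → y i + n × m ≤ sumOver y S
y[i]+n×min≤sumOver         {y = y} m≤0 m≤y (true ∷ S)  zero    here      =
  +-monoʳ-≤ (y zero) (n×min≤sumOver m≤0 (λ j → m≤y (suc j)) S)
y[i]+n×min≤sumOver {suc n} {m} {y} m≤0 m≤y (true ∷ S)  (suc i) (there i∈S) =
  ≤-trans (≤-reflexive (x∙yz≈y∙xz (y (suc i)) m (n × m)))
          (+-mono-≤ (m≤y zero) (y[i]+n×min≤sumOver m≤0 (λ j → m≤y (suc j)) S i i∈S))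
y[i]+n×min≤sumOver {suc n} {m} {y} m≤0 m≤y (false ∷ S) (suc i) (there i∈S) =
  ≤-trans (+-monoʳ-≤ (y (suc i)) (p≤0⇒p+q≤q m≤0))
          (y[i]+n×min≤sumOver m≤0 (λ j → m≤y (suc j)) S i i∈S)

InBase⇒sumOver≤ : ∀ {f : Subset n → ℤ} {y} → InBase f y → ∀ S → sumOver y S ≤ toℚ (f S)
InBase⇒sumOver≤ (proper , total) S with ≡-dec Bool._≟_ S ⊤
... | yes refl = ≤-reflexive total
... | no  S≢⊤  = proper S S≢⊤

⊥-inRingFamily : (A : Digraph n) → InRingFamily A ⊥
⊥-inRingFamily A i j _ i∈⊥ = ⊥-elim (∉⊥ i∈⊥)

IsMinimizerOver⇒≤f⊥ : ∀ {A : Digraph n} {f S} → IsMinimizerOver A f S → f S ℤ.≤ f ⊥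
IsMinimizerOver⇒≤f⊥ {A = A} (_ , minimal) = minimal ⊥ (⊥-inRingFamily A)

mainTheorem15 : (n : ℕ) (f : Subset n → ℤ) → Submodular f → f ⊥ ≡ + 0 →
    (A : Digraph n) → Acyclic A →
    (y : Fin n → ℚ) → InBase f y → NonDegenerate y →
    (i j₀ : Fin n) → (∀ (j : Fin n) → y j₀ ≤ y j) →
    y i > - (toℚ ((+ n) - (+ 1)) * y j₀) →
    ∀ (S : Subset n) → IsMinimizerOver A f S → i ∉ S
mainTheorem15 (suc k) f _ f⊥≡0 _ _ y inBase (_ , (j , yj<0)) i j₀ y₀≤y yi>-ky₀ S minimizer i∈S =
  ℤ.<-irrefl refl (ℤ.<-≤-trans (toℚ-cancel-< 0<fS) fS≤0)
  where
  y₀≤0 : y j₀ ≤ 0ℚ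
  y₀≤0 = ≤-trans (y₀≤y j) (<⇒≤ yj<0)
  0<fS : 0ℚ < toℚ (f S)
  0<fS = begin-strict
    0ℚ                        ≡⟨ sym (+-inverseˡ (toℚ (+ k) * y j₀)) ⟩
    - (toℚ (+ k) * y j₀) + toℚ (+ k) * y j₀ <⟨ +-monoˡ-< _ yi>-ky₀ ⟩
    y i + toℚ (+ k) * y j₀    ≡⟨ cong (λ q → y i + q) (sym (k×p≡toℚ[k]*p k (y j₀))) ⟩
    y i + k × y j₀            ≤⟨ y[i]+n×min≤sumOver y₀≤0 y₀≤y S i i∈S ⟩
    sumOver y S               ≤⟨ InBase⇒sumOver≤ {f = f} inBase S ⟩
    toℚ (f S)                 ∎
    where open ≤-Reasoning
  fS≤0 : f S ℤ.≤ + 0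
  fS≤0 = subst (f S ℤ.≤_) f⊥≡0 (IsMinimizerOver⇒≤f⊥ minimizer)
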